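{- Let $n\ge 2$. Then there exist integers $a,b\ge 1$ with $a\neq b$ such that $S=\{f,r^af,r^bf\}$ is a generating set of $D_n$ with $\lambda_1(D_n,S)\le\lfloor n/2\rfloor+1$.
   Context: The dihedral group $D_n$ is the group of order $2n$ with presentation $\langle r,f\mid r^n=f^2=1,\ rf=fr^{ -1}\rangle$. For a generating set $S$ of a finite group $G$ and $g\in G$, $l_S(g)$ is the minimal number of factors in an expression of $g$ as a product of elements of $S$ ($l_S(1)=0$). Define $\lambda_1(G,S)=\max_{g\in G,\,s\in S} l_S(gsg^{ -1})$. $\lfloor x\rfloor$ is the greatest integer $\le x$. -}

module Defs where

open import Data.Nat using (ℕ; zero; suc; _+_; _∸_; _≤_; NonZero)
open import Data.Nat.DivMod using (_mod_)
open import Data.Fin using (Fin; toℕ)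
open import Data.Bool using (Bool; true; false; _xor_)
open import Data.List using (List; []; _∷_; length)
open import Data.List.Relation.Unary.All using (All)
open import Data.Product using (Σ; _×_; _,_; ∃-syntax)
open import Data.Sum using (_⊎_)
open import Relation.Binary.PropositionalEquality using (_≡_)

-- Concrete model of the dihedral group D_n of order 2n:
-- the element  dih k e  stands for  r^k f^e  (k ∈ ℤ/n, e ∈ {0,1}, true = 1).
record Dih (n : ℕ) : Set where
  constructor dih
  field
    rot : Fin n
    flp : Bool
open Dih public

module _ {n : ℕ} {{_ : NonZero n}} where

  r^ : ℕ → Dih n
  r^ a = dih (a mod n) false

  fD : Dih n
  fD = dih (0 mod n) true

  -- r^k f^e · r^l f^e' = r^(k + (-1)^e l) f^(e + e')   (since f r = r^{-1} f)
  _·_ : Dih n → Dih n → Dih n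
  dih k false · dih l e' = dih ((toℕ k + toℕ l) mod n) e'
  dih k true  · dih l e' = dih ((toℕ k + (n ∸ toℕ l)) mod n) (true xor e')

  infixl 7 _·_

  one : Dih n
  one = dih (0 mod n) false

  inv : Dih n → Dih n
  inv (dih k false) = dih ((n ∸ toℕ k) mod n) false
  inv (dih k true)  = dih k true

  prod : List (Dih n) → Dih n
  prod []       = one
  prod (x ∷ xs) = x · prod xs

  lenLE : (S : Dih n → Set) → Dih n → ℕ → Set
  lenLE S g m = ∃[ w ] (All S w × prod w ≡ g × length w ≤ m)

  Generates : (Dih n → Set) → Set
  Generates S = (g : Dih n) → ∃[ w ] (All S w × prod w ≡ g)

  -- λ₁(D_n, S) ≤ m  :  l_S(g s g⁻¹) ≤ m for all g ∈ D_n, s ∈ S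
  lambda1LE : (Dih n → Set) → ℕ → Set
  lambda1LE S m = (g s : Dih n) → S s → lenLE S (g · s · inv g) m

  S3 : ℕ → ℕ → Dih n → Set
  S3 a b s = (s ≡ fD) ⊎ (s ≡ r^ a · fD) ⊎ (s ≡ r^ b · fD)

-- Every element of D_n is a rotation r^k or a reflection r^t f, and every
-- conjugate of a reflection is again a reflection.  We take
-- S = {f, r f, r² f} (a = 1, b = 2); then λ₁(D_n, S) ≤ ⌊n/2⌋ + 1 follows once
-- every reflection has S-length at most ⌊n/2⌋ + 1.
--
-- The key identities are  (r² f)·f = r²  and  f·(r² f) = r⁻², so prefixing
-- a word for r^t f by  r²f·f  (resp.  f·r²f) yields r^(t+2) f (resp.
-- r^(t-2) f) at a cost of two letters.  Going up from r f or r² f reaches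
-- r^t f with t letters; going down from f or r⁻¹ f reaches r^(n-u) f with
-- u + 2 letters.  Since n ≤ 2⌊n/2⌋ + 1, for each 0 ≤ t < n one of the two
-- routes has length at most ⌊n/2⌋ + 1.  Rotations are f times a reflection,
-- so S also generates D_n.
module Submission where

open import Defs
open import Data.Nat using (ℕ; _≤_; _/_; _+_; NonZero)
open import Data.Product using (_×_; ∃-syntax)
open import Relation.Binary.PropositionalEquality using (_≢_)

open import Data.Nat using (zero; suc; _*_; _∸_; _%_; _<_; z≤n; s≤s; s≤s⁻¹; _≤?_)
open import Data.Nat.Properties
open import Data.Nat.DivMod
open import Data.Nat.Solver using (module +-*-Solver)
open import Data.Fin using (Fin; toℕ)
open import Data.Fin.Properties using (toℕ-injective; toℕ-fromℕ<; toℕ<n)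
open import Data.Bool using (true; false; not)
open import Data.List using ([]; _∷_)
open import Data.List.Relation.Unary.All using ([]; _∷_)
open import Data.Product using (_,_)
open import Data.Sum using (inj₁; inj₂)
open import Relation.Binary.PropositionalEquality
  using (_≡_; refl; sym; trans; cong; cong₂; subst; module ≡-Reasoning)
open import Relation.Nullary using (yes; no)

-- m ≤ 2⌊m/2⌋ + 1: the up and down routes together cover a full turn.
m≤2[m/2]+1 : ∀ m → m ≤ (m / 2 + 1) + m / 2
m≤2[m/2]+1 m = begin
    m                 ≡⟨ m≡m%n+[m/n]*n m 2 ⟩
    m % 2 + h * 2     ≤⟨ +-monoˡ-≤ (h * 2) (s≤s⁻¹ (m%n<n m 2)) ⟩
    1 + h * 2         ≡⟨ solve 1 (λ x → con 1 :+ x :* con 2 := (x :+ con 1) :+ x) refl h ⟩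
    (h + 1) + h       ∎
  where
  open ≤-Reasoning
  open +-*-Solver
  h : ℕ
  h = m / 2

-- If t is past the half-way point n/2 + 1, going down from r^n f = f to
-- r^t f takes at most n/2 + 1 letters.
far-side-bound : ∀ n t → n / 2 + 1 < t → t ≤ n → 2 + (n ∸ t) ≤ n / 2 + 1
far-side-bound n t far t≤n = +-cancelʳ-≤ h (2 + u) (h + 1) (begin
    (2 + u) + h       ≡⟨ solve 2 (λ x y → (con 2 :+ x) :+ y := x :+ (con 1 :+ (y :+ con 1))) refl u h ⟩
    u + suc (h + 1)   ≤⟨ +-monoʳ-≤ u far ⟩
    u + t             ≡⟨ m∸n+n≡m t≤n ⟩
    n                 ≤⟨ m≤2[m/2]+1 n ⟩
    (h + 1) + h       ∎)
  where
  open ≤-Reasoning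
  open +-*-Solver
  h u : ℕ
  h = n / 2
  u = n ∸ t

module _ {n : ℕ} {{_ : NonZero n}} where

  reflection : ℕ → Dih n
  reflection t = dih (t mod n) true

  toℕ-mod : ∀ a → toℕ (a mod n) ≡ a % n
  toℕ-mod a = toℕ-fromℕ< (m%n<n a n)

  mod-cong : ∀ {a b} → a % n ≡ b % n → a mod n ≡ b mod n
  mod-cong {a} {b} eq = toℕ-injective (trans (toℕ-mod a) (trans eq (sym (toℕ-mod b))))

  canonical : ∀ (k : Fin n) e → dih k e ≡ dih (toℕ k mod n) e
  canonical k e = cong (λ j → dih j e)
    (toℕ-injective (sym (trans (toℕ-mod (toℕ k)) (m<n⇒m%n≡m (toℕ<n k)))))

  %-absorbˡ : ∀ a b → (a % n + b) % n ≡ (a + b) % n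
  %-absorbˡ a b = begin
      (a % n + b) % n           ≡⟨ %-distribˡ-+ (a % n) b n ⟩
      (a % n % n + b % n) % n   ≡⟨ cong (λ x → (x + b % n) % n) (m%n%n≡m%n a n) ⟩
      (a % n + b % n) % n       ≡⟨ sym (%-distribˡ-+ a b n) ⟩
      (a + b) % n               ∎
    where open ≡-Reasoning

  subtract-mod : ∀ c b → ((c + b) % n + (n ∸ b % n)) % n ≡ c % n
  subtract-mod c b = begin
      ((c + b) % n + d) % n          ≡⟨ %-absorbˡ (c + b) d ⟩
      (c + b + d) % n                ≡⟨ cong (λ x → (c + x + d) % n) (m≡m%n+[m/n]*n b n) ⟩
      (c + (r + q) + d) % n          ≡⟨ cong (_% n) regroup ⟩
      (c + suc (b / n) * n) % n      ≡⟨ [m+kn]%n≡m%n c (suc (b / n)) n ⟩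
      c % n                          ∎
    where
    open ≡-Reasoning
    r q d : ℕ
    r = b % n
    q = (b / n) * n
    d = n ∸ r
    regroup : c + (r + q) + d ≡ c + (n + q)
    regroup = begin
      c + (r + q) + d    ≡⟨ +-assoc c (r + q) d ⟩
      c + (r + q + d)    ≡⟨ cong (c +_) (+-assoc r q d) ⟩
      c + (r + (q + d))  ≡⟨ cong (λ x → c + (r + x)) (+-comm q d) ⟩
      c + (r + (d + q))  ≡⟨ cong (c +_) (sym (+-assoc r d q)) ⟩
      c + (r + d + q)    ≡⟨ cong (λ x → c + (x + q)) (m+[n∸m]≡n (m%n≤n b n)) ⟩
      c + (n + q)        ∎

  rotation-mul : ∀ a b e → r^ a · dih (b mod n) e ≡ dih ((a + b) mod n) e
  rotation-mul a b e = cong (λ k → dih k e) (mod-cong (trans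
    (cong₂ (λ x y → (x + y) % n) (toℕ-mod a) (toℕ-mod b)) (sym (%-distribˡ-+ a b n))))

  reflection-mul : ∀ {a b c} e → (c + b) % n ≡ a % n →
    reflection a · dih (b mod n) e ≡ dih (c mod n) (not e)
  reflection-mul {a} {b} {c} e c+b≡a = cong (λ k → dih k (not e)) (mod-cong (begin
      (toℕ (a mod n) + (n ∸ toℕ (b mod n))) % n
        ≡⟨ cong₂ (λ x y → (x + (n ∸ y)) % n) (toℕ-mod a) (toℕ-mod b) ⟩
      (a % n + (n ∸ b % n)) % n
        ≡⟨ cong (λ x → (x + (n ∸ b % n)) % n) (sym c+b≡a) ⟩
      ((c + b) % n + (n ∸ b % n)) % n
        ≡⟨ subtract-mod c b ⟩
      c % n ∎))
    where open ≡-Reasoning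

  reflection-period : ∀ t → reflection (t + n) ≡ reflection t
  reflection-period t = cong (λ k → dih k true) (mod-cong ([m+n]%n≡m%n t n))

  reflection-·one : ∀ t → reflection t · one ≡ reflection t
  reflection-·one t = reflection-mul false (cong (_% n) (+-identityʳ t))

  -- k + t + (n ∸ t) ≡ k (mod n): the pivot r^(n∸t) = r^(-t) of both shifts.
  pivot : ∀ k t → t ≤ n → (k + t + (n ∸ t)) % n ≡ k % n
  pivot k t t≤n = trans
    (cong (_% n) (trans (+-assoc k t (n ∸ t)) (cong (k +_) (m+[n∸m]≡n t≤n))))
    ([m+n]%n≡m%n k n)

  pivot′ : ∀ k t → t ≤ n → ((n ∸ t) + (k + t)) % n ≡ k % n
  pivot′ k t t≤n = trans (cong (_% n) (+-comm (n ∸ t) (k + t))) (pivot k t t≤n)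

  conjugate-reflection : ∀ (g : Dih n) m → ∃[ m′ ] (g · dih m true · inv g ≡ dih m′ true)
  conjugate-reflection (dih k false) m = _ , refl
  conjugate-reflection (dih k true)  m = _ , refl

  S3-reflection : ∀ {a b} {s : Dih n} → S3 a b s → ∃[ m ] (s ≡ dih m true)
  S3-reflection (inj₁ refl)        = _ , refl
  S3-reflection (inj₂ (inj₁ refl)) = _ , refl
  S3-reflection (inj₂ (inj₂ refl)) = _ , refl

  S : Dih n → Set
  S = S3 1 2

  f∈S : S fD
  f∈S = inj₁ refl

  rf∈S : S (r^ 1 · fD)
  rf∈S = inj₂ (inj₁ refl)

  r²f∈S : S (r^ 2 · fD)
  r²f∈S = inj₂ (inj₂ refl)

  generator-reflection : ∀ j → r^ j · fD ≡ reflection j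
  generator-reflection j = trans (rotation-mul j 0 true) (cong reflection (+-identityʳ j))

  -- (r² f)·(f · r^t f) = r^(t+2) f,  via  f · r^t f = r^(-t).
  shift-up : ∀ t → t ≤ n → (r^ 2 · fD) · (fD · reflection t) ≡ reflection (2 + t)
  shift-up t t≤n = begin
      (r^ 2 · fD) · (fD · reflection t)
        ≡⟨ cong₂ _·_ (generator-reflection 2) (reflection-mul true (pivot′ 0 t t≤n)) ⟩
      reflection 2 · r^ (n ∸ t)
        ≡⟨ reflection-mul false (pivot 2 t t≤n) ⟩
      reflection (2 + t) ∎
    where open ≡-Reasoning

  -- f·(r² f · r^(t+2) f) = r^t f,  via  r² f · r^(t+2) f = r^(-t).
  shift-down : ∀ t → t ≤ n → fD · ((r^ 2 · fD) · reflection (2 + t)) ≡ reflection t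
  shift-down t t≤n = begin
      fD · ((r^ 2 · fD) · reflection (2 + t))
        ≡⟨ cong (λ x → fD · (x · reflection (2 + t))) (generator-reflection 2) ⟩
      fD · (reflection 2 · reflection (2 + t))
        ≡⟨ cong (fD ·_) (reflection-mul true (pivot′ 2 t t≤n)) ⟩
      fD · r^ (n ∸ t)
        ≡⟨ reflection-mul false (pivot 0 t t≤n) ⟩
      reflection t ∎
    where open ≡-Reasoning

  weaken : ∀ {g m m′} → lenLE S g m → m ≤ m′ → lenLE S g m′
  weaken (w , w∈S , prod-w , len) m≤m′ = w , w∈S , prod-w , ≤-trans len m≤m′

  one-letter : ∀ {s} t → S s → s ≡ reflection t → lenLE S (reflection t) 1
  one-letter t s∈S s≡ = _ ∷ [] , s∈S ∷ [] , trans (cong (_· one) s≡) (reflection-·one t) , ≤-refl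

  ascend : ∀ {m} t → t ≤ n → lenLE S (reflection t) m → lenLE S (reflection (2 + t)) (2 + m)
  ascend t t≤n (w , w∈S , prod-w , len) =
    r^ 2 · fD ∷ fD ∷ w , r²f∈S ∷ f∈S ∷ w∈S ,
    trans (cong (λ x → (r^ 2 · fD) · (fD · x)) prod-w) (shift-up t t≤n) , s≤s (s≤s len)

  descend : ∀ {m} t → t ≤ n → lenLE S (reflection (2 + t)) m → lenLE S (reflection t) (2 + m)
  descend t t≤n (w , w∈S , prod-w , len) =
    fD ∷ r^ 2 · fD ∷ w , f∈S ∷ r²f∈S ∷ w∈S ,
    trans (cong (λ x → fD · ((r^ 2 · fD) · x)) prod-w) (shift-down t t≤n) , s≤s (s≤s len)

  route-up : ∀ t → t < n → lenLE S (reflection (suc t)) (suc t)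
  route-up zero          _  = one-letter 1 rf∈S (generator-reflection 1)
  route-up (suc zero)    _  = weaken (one-letter 2 r²f∈S (generator-reflection 2)) (s≤s z≤n)
  route-up (suc (suc t)) lt = ascend (suc t) t+1≤n (route-up t t+1≤n)
    where
    t+1≤n : suc t ≤ n
    t+1≤n = ≤-trans (m≤n+m (suc t) 2) lt

  route-down : ∀ u t → t + u ≡ n → lenLE S (reflection t) (2 + u)
  route-down zero t t+0≡n = weaken (one-letter t f∈S f≡) (s≤s z≤n)
    where
    f≡ : fD ≡ reflection t
    f≡ = trans (sym (reflection-period 0)) (cong reflection (trans (sym t+0≡n) (+-identityʳ t)))
  route-down (suc zero) t t+1≡n =
    descend t (subst (t ≤_) t+1≡n (m≤m+n t 1)) (one-letter (2 + t) rf∈S rf≡)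
    where
    rf≡ : r^ 1 · fD ≡ reflection (2 + t)
    rf≡ = trans (generator-reflection 1)
      (trans (sym (reflection-period 1)) (cong (λ x → reflection (suc x)) (sym (trans (+-comm 1 t) t+1≡n))))
  route-down (suc (suc u)) t t+u+2≡n =
    descend t (subst (t ≤_) t+u+2≡n (m≤m+n t (2 + u))) (route-down u (2 + t) 2+t+u≡n)
    where
    2+t+u≡n : 2 + t + u ≡ n
    2+t+u≡n = trans (sym (trans (+-suc t (suc u)) (cong suc (+-suc t u)))) t+u+2≡n

  reflection-length< : ∀ t → t < n → lenLE S (reflection t) (n / 2 + 1)
  reflection-length< zero    _ = weaken (one-letter 0 f∈S refl) (m≤n+m 1 (n / 2))
  reflection-length< (suc t) t+1<n with suc t ≤? n / 2 + 1
  ... | yes near = weaken (route-up t (<-trans (n<1+n t) t+1<n)) near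
  ... | no  far  = weaken (route-down (n ∸ suc t) (suc t) (m+[n∸m]≡n (<⇒≤ t+1<n)))
                          (far-side-bound n (suc t) (≰⇒> far) (<⇒≤ t+1<n))

  reflection-length : ∀ t → lenLE S (reflection t) (n / 2 + 1)
  reflection-length t =
    subst (λ g → lenLE S g (n / 2 + 1))
          (cong (λ k → dih k true) (mod-cong (m%n%n≡m%n t n)))
          (reflection-length< (t % n) (m%n<n t n))

  -- S generates D_n: reflections directly, and  r^k = f · r^(n∸k) f.
  generates : Generates S
  generates (dih k true) with reflection-length (toℕ k)
  ... | w , w∈S , prod-w , _ = w , w∈S , trans prod-w (sym (canonical k true))
  generates (dih k false) with reflection-length (n ∸ toℕ k)
  ... | w , w∈S , prod-w , _ = fD ∷ w , f∈S ∷ w∈S , (begin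
      fD · prod w                        ≡⟨ cong (fD ·_) prod-w ⟩
      fD · reflection (n ∸ toℕ k)        ≡⟨ reflection-mul true (pivot 0 (toℕ k) (<⇒≤ (toℕ<n k))) ⟩
      dih (toℕ k mod n) false            ≡⟨ sym (canonical k false) ⟩
      dih k false                        ∎)
    where open ≡-Reasoning

  conjugate-length : lambda1LE S (n / 2 + 1)
  conjugate-length g s s∈S with S3-reflection s∈S
  ... | m , refl with conjugate-reflection g m
  ...   | m′ , eq = subst (λ x → lenLE S x (n / 2 + 1))
                      (trans (sym (canonical m′ true)) (sym eq)) (reflection-length (toℕ m′))

theorem11 : (n : ℕ) {{_ : NonZero n}} → 2 ≤ n →
    ∃[ a ] ∃[ b ] (1 ≤ a × 1 ≤ b × a ≢ b ×
      Generates {n} (S3 {n} a b) × lambda1LE {n} (S3 {n} a b) (n / 2 + 1))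
theorem11 n _ = 1 , 2 , s≤s z≤n , s≤s z≤n , (λ ()) , generates , conjugate-length
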